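{- Let $\Phi$, $G$ and $k$ be as described in the context. If there exists a clique cover of $G$ of size at most $k$ (a family of at most $k$ vertex sets, each inducing a complete subgraph of $G$, such that every edge of $G$ has both endpoints in some member), then $\Phi$ is satisfiable.
   Context: Let $n = 2^\ell$ with $\ell \geq 1$ and let $\Phi = \Psi_0 \wedge \dots \wedge \Psi_{m-1}$ ($m\ge1$) be a 3-CNF formula over variables $x_0,\dots,x_{n-1}$ in which every clause consists of exactly three literals on pairwise distinct variables and the variable $x_0$ occurs in no clause. For $0 \le j < m$ and $\alpha \in \{1,2,3\}$, let $i(j,\alpha)$ be the index of the variable of the $\alpha$-th literal of $\Psi_j$, and $c(j,\alpha) = 1$ if this literal is positive, $c(j,\alpha)=0$ if negative. The graph $G_0$ has vertices $w^\eta_{i,c}$ ($\eta\in\{1,2\}$, $0\le i<n$, $c\in\{0,1\}$), $u^\eta_\gamma$ ($\eta\in\{1,2\}$, $1\le\gamma\le \ell-1$), $p_{j,\alpha,\beta}$ ($0\le j<m$, $\alpha\in\{1,2,3\}$, $\beta\in\{1,2\}$), $q_{a,b}$ ($a,b\in\{1,2\}$), and edge set $E^{\mathrm{imp}} \cup E^{\mathrm{free}}$ where $E^{\mathrm{imp}}$ consists of: $w^\eta_{i,0}w^\eta_{i',1}$ for all $\eta$ and $i\ne i'$; $u^\eta_\gamma w^\eta_{i,c}$ for all $\eta,\gamma,i,c$; $p_{j,\alpha,1}p_{j,\alpha,2}$; $q_{a,1}q_{a,2}$; and $E^{\mathrm{free}}$ consists of: $w^\eta_{i,c}w^\eta_{i',c}$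 for $i\ne i'$; $w^1_{i,c}w^2_{i',c'}$ for all $i,c,i',c'$; $q_{a,b}p_{j,\alpha,\beta}$ for all indices; $p_{j,\alpha,\beta}p_{j',\alpha',\beta'}$ for $j\ne j'$; $p_{j,\alpha,\beta}w^\eta_{i,c}$ for all $j,\alpha,\beta,\eta$ and $(i,c) \notin \{(0,1),(i(j,\alpha),1-c(j,\alpha))\}$; no other edges. For a nonnegative integer $t$, "the $\gamma$-th bit of $t$" means the $\gamma$-th least significant bit of its binary representation. Let $\mathcal{D}$ be the following indexed family of vertex sets (cliques of $(V(G_0),E^{\mathrm{free}})$), of total size $N = 46 + 36\lceil\log_2 m\rceil + 24\ell$: (1) for $(c,c')\in\{0,1\}^2$: $\{w^1_{i,c}: 0\le i<n\}\cup\{w^2_{i,c'}:0\le i<n\}$; (2) for $(a,b,\alpha',\beta')\in\{1,2\}^2\times\{1,2,3\}\times\{1,2\}$: $\{q_{a,b}\}\cup\{p_{j,\alpha',\beta'}:0\le j<m\}$; (3) for $1\le\gamma\le\lceil\log_2 m\rceil$ and $(\alpha,\beta,\alpha',\beta')\in(\{1,2,3\}\times\{1,2\})^2$: $\{p_{j,\alpha,\beta}: \text{the }\gamma\text{ -th bit of } j \text{ is } 0\}\cup\{p_{j,\alpha',\beta'}: \text{the }\gamma\text{ -th bit of } j\text{ is }1\}$; (4) for $(\alpha,\beta)\in\{1,2,3\}\times\{1,2\}$: $\{w^1_{0,0},w^2_{0,0}\}\cup\{p_{j,\alpha,\beta}:0\le j<m\}$; (5) for $(\alpha,\beta,c)\in\{1,2,3\}\times\{1,2\}\times\{0,1\}$: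 $\{w^\eta_{i,c}:1\le i<n,\eta\in\{1,2\}\}\cup\{p_{j,\alpha,\beta}: c(j,\alpha)=c\}$; (6) for $1\le\gamma\le\ell$ and $(\alpha,\beta,c,c')\in\{1,2,3\}\times\{1,2\}\times\{0,1\}^2$: $\{w^\eta_{i,c}:\eta\in\{1,2\},1\le i<n,\text{ the }\gamma\text{ -th bit of } i\text{ is } c'\}\cup\{p_{j,\alpha,\beta}: \text{the }\gamma\text{ -th bit of } i(j,\alpha)\text{ is } 1-c'\}$. The graph $G$ is obtained from $G_0$ by adding, for each of the $N$ members $D$ of $\mathcal{D}$, a new vertex $s_D$ adjacent exactly to the vertices of $D$ (the new vertices are pairwise non-adjacent). Set $k = 4\ell + 46 + 36\lceil\log_2 m\rceil + 24\ell$. -}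

module Defs where

open import Data.Nat using (ℕ; zero; suc; _+_; _*_; _∸_; _^_; _≤_; _≡ᵇ_)
open import Data.Nat.DivMod using (_/_; _%_)
open import Data.Nat.Logarithm using (⌈log₂_⌉)
open import Data.Fin using (Fin; toℕ)
open import Data.Bool using (Bool; true; false; not)
open import Data.Product using (Σ; ∃; _×_; _,_)
open import Data.Sum using (_⊎_)
open import Relation.Nullary using (¬_)
open import Relation.Binary.PropositionalEquality using (_≡_; _≢_)

-- testBit t g : the (g+1)-th least significant bit of t  (true = 1).
-- So "the γ-th bit of t" (γ ≥ 1) is  testBit t (γ ∸ 1).
testBit : ℕ → ℕ → Bool
testBit t zero    = t % 2 ≡ᵇ 1
testBit t (suc g) = testBit (t / 2) g

L : ℕ → ℕ
L m = ⌈log₂ m ⌉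

-- Index set of the family 𝒟 (one constructor per item (1)-(6)).
-- Conventions: Fin 2 encodes {1,2} (zero ↦ 1), Fin 3 encodes {1,2,3} (zero ↦ 1),
-- Bool encodes {0,1} (false ↦ 0, true ↦ 1).
-- γ in item (3) ranges over Fin (L m): value g ↦ γ = g+1; in item (6) over Fin ℓ likewise.
data DIdx (ℓ m : ℕ) : Set where
  d1 : (c c' : Bool) → DIdx ℓ m
  d2 : (a b : Fin 2) (α' : Fin 3) (β' : Fin 2) → DIdx ℓ m
  d3 : (γ : Fin (L m)) (α : Fin 3) (β : Fin 2) (α' : Fin 3) (β' : Fin 2) → DIdx ℓ m
  d4 : (α : Fin 3) (β : Fin 2) → DIdx ℓ m
  d5 : (α : Fin 3) (β : Fin 2) (c : Bool) → DIdx ℓ m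
  d6 : (γ : Fin ℓ) (α : Fin 3) (β : Fin 2) (c c' : Bool) → DIdx ℓ m

-- Vertices of G (n = 2^ℓ). u η γ : γ ∈ Fin (ℓ ∸ 1) encodes γ+1 ∈ {1..ℓ-1}.
data Vertex (ℓ m : ℕ) : Set where
  w : (η : Fin 2) (i : Fin (2 ^ ℓ)) (c : Bool) → Vertex ℓ m
  u : (η : Fin 2) (γ : Fin (ℓ ∸ 1)) → Vertex ℓ m
  p : (j : Fin m) (α : Fin 3) (β : Fin 2) → Vertex ℓ m
  q : (a b : Fin 2) → Vertex ℓ m
  s : DIdx ℓ m → Vertex ℓ m

-- A 3-CNF formula over x_0..x_{2^ℓ - 1} with m clauses:
-- var j α = i(j,α),  sgn j α = c(j,α)  (true = positive literal).
record Formula (ℓ m : ℕ) : Set where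
  field
    var : Fin m → Fin 3 → Fin (2 ^ ℓ)
    sgn : Fin m → Fin 3 → Bool

WellFormed : ∀ {ℓ m} → Formula ℓ m → Set
WellFormed Φ =
  (∀ j α α' → α ≢ α' → var j α ≢ var j α') × (∀ j α → toℕ (var j α) ≢ 0)
  where open Formula Φ

Satisfiable : ∀ {ℓ m} → Formula ℓ m → Set
Satisfiable {ℓ} {m} Φ =
  Σ (Fin (2 ^ ℓ) → Bool) λ a → ∀ (j : Fin m) → ∃ λ (α : Fin 3) → a (var j α) ≡ sgn j α
  where open Formula Φ

module _ {ℓ m : ℕ} (Φ : Formula ℓ m) where
  open Formula Φ

  -- E^imp (as ordered pairs; the graph is its symmetric closure below)
  Eimp : Vertex ℓ m → Vertex ℓ m → Set
  Eimp (w η i false) (w η' i' true) = η ≡ η' × i ≢ i'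
  Eimp (u η γ) (w η' i c) = η ≡ η'
  Eimp (p j α Fin.zero) (p j' α' (Fin.suc Fin.zero)) = j ≡ j' × α ≡ α'
  Eimp (q a Fin.zero) (q a' (Fin.suc Fin.zero)) = a ≡ a'
  Eimp _ _ = Data.Empty.⊥
    where import Data.Empty

  Efree : Vertex ℓ m → Vertex ℓ m → Set
  Efree (w η i c) (w η' i' c') =
    (η ≡ η' × i ≢ i' × c ≡ c') ⊎ (toℕ η ≡ 0 × toℕ η' ≡ 1)
  Efree (q a b) (p j α β) = Data.Unit.⊤
    where import Data.Unit
  Efree (p j α β) (p j' α' β') = j ≢ j'
  Efree (p j α β) (w η i c) =
    ¬ ((toℕ i ≡ 0 × c ≡ true) ⊎ (i ≡ var j α × c ≡ not (sgn j α)))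
  Efree _ _ = Data.Empty.⊥
    where import Data.Empty

  InD : DIdx ℓ m → Vertex ℓ m → Set
  InD (d1 c₀ c₀') (w η i c) = (toℕ η ≡ 0 × c ≡ c₀) ⊎ (toℕ η ≡ 1 × c ≡ c₀')
  InD (d2 a₀ b₀ α₀ β₀) (q a b) = a ≡ a₀ × b ≡ b₀
  InD (d2 a₀ b₀ α₀ β₀) (p j α β) = α ≡ α₀ × β ≡ β₀
  InD (d3 γ α₀ β₀ α₁ β₁) (p j α β) =
    (testBit (toℕ j) (toℕ γ) ≡ false × α ≡ α₀ × β ≡ β₀)
    ⊎ (testBit (toℕ j) (toℕ γ) ≡ true × α ≡ α₁ × β ≡ β₁)
  InD (d4 α₀ β₀) (w η i c) = toℕ i ≡ 0 × c ≡ false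
  InD (d4 α₀ β₀) (p j α β) = α ≡ α₀ × β ≡ β₀
  InD (d5 α₀ β₀ c₀) (w η i c) = 1 ≤ toℕ i × c ≡ c₀
  InD (d5 α₀ β₀ c₀) (p j α β) = α ≡ α₀ × β ≡ β₀ × sgn j α₀ ≡ c₀
  InD (d6 γ α₀ β₀ c₀ c₀') (w η i c) =
    c ≡ c₀ × 1 ≤ toℕ i × testBit (toℕ i) (toℕ γ) ≡ c₀'
  InD (d6 γ α₀ β₀ c₀ c₀') (p j α β) =
    α ≡ α₀ × β ≡ β₀ × testBit (toℕ (var j α₀)) (toℕ γ) ≡ not c₀'
  InD _ _ = Data.Empty.⊥
    where import Data.Empty

  E : Vertex ℓ m → Vertex ℓ m → Set
  E (s d) v = InD d v
  E x y = Eimp x y ⊎ Efree x y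

  Adj : Vertex ℓ m → Vertex ℓ m → Set
  Adj x y = E x y ⊎ E y x

  IsClique : (Vertex ℓ m → Bool) → Set
  IsClique S = ∀ x y → S x ≡ true → S y ≡ true → x ≢ y → Adj x y

  IsCliqueCover : (r : ℕ) → (Fin r → Vertex ℓ m → Bool) → Set
  IsCliqueCover r C =
    (∀ t → IsClique (C t))
    × (∀ x y → Adj x y → ∃ λ t → C t x ≡ true × C t y ≡ true)

kBound : ℕ → ℕ → ℕ
kBound ℓ m = 4 * ℓ + 46 + 36 * L m + 24 * ℓ

-- A cover needs distinct cliques for the edges at the s_D, for the edges u^η_γ w^η_{0,c} and for the
-- edges q_{a,1} q_{a,2}, because the endpoints of any two of these edges include a non-adjacent pair.
-- These are k - 2 cliques, so at most two further ("fresh") cliques exist.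
--
-- If some w^η_{i,c} lies in neither clique through u^η_γ, the edge u^η_γ w^η_{i,c} needs a fresh
-- clique. This cannot happen for both η (a fresh clique through some p_{0,α,1} p_{0,α,2}, which exists
-- since only two cliques contain q's, would be a third), nor for η = 0 while the u^1-cliques cover all
-- w^1 (two indices i ≠ i' on which the u^1-cliques agree give fresh cliques through w^1_{i,0} w^1_{i',1}
-- and w^1_{i',0} w^1_{i,1}).
--
-- So the u^0-cliques cover all w^0_{i,c}, and the pattern of the u^0-cliques on w^0_{i,1} is a
-- signature of i in {0,1}^{ℓ-1}. An edge w_{i,0} w_{i',1} between indices of equal signature lies in no
-- u-clique, hence in a fresh clique; three indices of equal signature would give three fresh cliques,
-- so by counting (2^ℓ indices, 2^{ℓ-1} signatures) every index has exactly one partner. The fresh clique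
-- O through w_{0,0} then contains w_{i,0} or w_{i,1} for every i, and p_{j,α,1} for some α in every
-- clause j (the other fresh clique contains w_{0,1}, which is not adjacent to any p). Since O is a
-- clique, the assignment x_i := [w_{i,1} ∈ O] makes the literal of that p_{j,α,1} true.

module Submission where

open import Defs
open import Data.Nat using (ℕ; zero; suc; _+_; _*_; _^_; _≤_; _<_; z≤n; s≤s; _/_)
import Data.Nat.Properties as ℕ
open import Data.Nat.DivMod using (m*n/n≡m)
open import Data.Nat.Tactic.RingSolver using (solve-∀)
open import Data.Fin using (Fin; zero; suc; toℕ; fromℕ<; combine; punchOut)
  renaming (_<_ to _<ᶠ_; _<?_ to _<ᶠ?_)
import Data.Fin.Properties as Fin
open import Data.Bool using (Bool; true; false; not)
open import Data.Bool.Properties using (not-¬; ¬-not)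
open import Data.Product using (∃; _×_; _,_; proj₁; proj₂; map₂)
open import Data.Product.Properties using (,-injective)
open import Data.Product.Function.NonDependent.Propositional using (_×-↔_; _×-↣_)
open import Data.Sum using (_⊎_; inj₁; inj₂; [_,_]′)
open import Data.Sum.Function.Propositional using (_⊎-↣_)
open import Data.Empty using (⊥; ⊥-elim)
open import Function using (_∘_; _↔_; _↣_; Injection; Inverse; mk↣)
open import Function.Definitions using (Injective)
open import Function.Properties.Injection using (↣-refl; ↣-trans)
open import Function.Properties.Inverse using (↔-refl; ↔-sym; ↔-trans; ↔⇒↣)
open import Relation.Nullary using (¬_; Dec; yes; no; does; _×-dec_; _⊎-dec_; contradiction)
open import Relation.Nullary.Decidable using (dec-true; decidable-stable)
open import Relation.Binary.Definitions using (tri<; tri≈; tri>)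
open import Relation.Binary.PropositionalEquality

↔-injective : ∀ {A B : Set} (e : A ↔ B) → Injective _≡_ _≡_ (Inverse.to e)
↔-injective e = Injection.injective (↔⇒↣ e)

≢-preserving⇒≤ : ∀ {A : Set} {n r} → Fin n ↣ A → (f : A → Fin r) → (∀ {x y} → x ≢ y → f x ≢ f y) → n ≤ r
≢-preserving⇒≤ e f f-pres = Fin.injective⇒≤ λ {k} {k'} eq →
  decidable-stable (k Fin.≟ k') λ k≢k' → f-pres (k≢k' ∘ Injection.injective e) eq

Fin+↣⊎ : ∀ {a b} {A B : Set} → Fin a ↣ A → Fin b ↣ B → Fin (a + b) ↣ (A ⊎ B)
Fin+↣⊎ eA eB = ↣-trans (↔⇒↣ Fin.+↔⊎) (eA ⊎-↣ eB)

Fin*↣× : ∀ {a b} {A B : Set} → Fin a ↣ A → Fin b ↣ B → Fin (a * b) ↣ (A × B)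
Fin*↣× eA eB = ↣-trans (↔⇒↣ Fin.*↔×) (eA ×-↣ eB)

≢-preserving+3⇒≤ : ∀ {A : Set} {n r} → Fin n ↣ A → (f : A → Fin r) → (∀ {x y} → x ≢ y → f x ≢ f y)
  → ∀ {t₁ t₂ t₃} → (∀ x → t₁ ≢ f x) → (∀ x → t₂ ≢ f x) → (∀ x → t₃ ≢ f x)
  → t₁ ≢ t₂ → t₁ ≢ t₃ → t₂ ≢ t₃ → n + 3 ≤ r
≢-preserving+3⇒≤ {A} {r = r} e f f-≢ {t₁} {t₂} {t₃} ∉f₁ ∉f₂ ∉f₃ t₁≢t₂ t₁≢t₃ t₂≢t₃ =
  ≢-preserving⇒≤ (Fin+↣⊎ e ↣-refl) extend extend-≢
  where
  t : Fin 3 → Fin r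
  t zero             = t₁
  t (suc zero)       = t₂
  t (suc (suc zero)) = t₃

  t∉f : ∀ k x → t k ≢ f x
  t∉f zero             = ∉f₁
  t∉f (suc zero)       = ∉f₂
  t∉f (suc (suc zero)) = ∉f₃

  t-≢ : ∀ {k k'} → k ≢ k' → t k ≢ t k'
  t-≢ {zero}           {suc zero}       _ = t₁≢t₂
  t-≢ {zero}           {suc (suc zero)} _ = t₁≢t₃
  t-≢ {suc zero}       {suc (suc zero)} _ = t₂≢t₃
  t-≢ {suc zero}       {zero}           _ = ≢-sym t₁≢t₂
  t-≢ {suc (suc zero)} {zero}           _ = ≢-sym t₁≢t₃
  t-≢ {suc (suc zero)} {suc zero}       _ = ≢-sym t₂≢t₃
  t-≢ {zero}           {zero}           k≢k' = contradiction refl k≢k'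
  t-≢ {suc zero}       {suc zero}       k≢k' = contradiction refl k≢k'
  t-≢ {suc (suc zero)} {suc (suc zero)} k≢k' = contradiction refl k≢k'

  extend : A ⊎ Fin 3 → Fin r
  extend = [ f , t ]′

  extend-≢ : ∀ {x y} → x ≢ y → extend x ≢ extend y
  extend-≢ {inj₁ a} {inj₁ a'} ne = f-≢ (ne ∘ cong inj₁)
  extend-≢ {inj₁ a} {inj₂ k}  _  = ≢-sym (t∉f k a)
  extend-≢ {inj₂ k} {inj₁ a}  _  = t∉f k a
  extend-≢ {inj₂ k} {inj₂ k'} ne = t-≢ (ne ∘ cong inj₂)

injective⇒surjective : ∀ {n} {f : Fin n → Fin n} → Injective _≡_ _≡_ f → ∀ y → ∃ λ x → f x ≡ y
injective⇒surjective {suc n} {f} f-inj y with Fin.any? (λ x → f x Fin.≟ y)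
... | yes hit = hit
... | no miss = contradiction (Fin.injective⇒≤ avoid-y-injective) ℕ.1+n≰n
  where
  avoid-y : Fin (suc n) → Fin n
  avoid-y x = punchOut {i = y} {j = f x} (λ y≡fx → miss (x , sym y≡fx))
  avoid-y-injective : Injective _≡_ _≡_ avoid-y
  avoid-y-injective eq = f-inj (Fin.punchOut-injective {i = y} _ _ eq)

↔-injective⇒surjective : ∀ {n} {A : Set} → Fin n ↔ A → {f : Fin n → A} → Injective _≡_ _≡_ f
  → ∀ y → ∃ λ x → f x ≡ y
↔-injective⇒surjective e f-inj y with injective⇒surjective (f-inj ∘ ↔-injective (↔-sym e)) (Inverse.from e y)
... | x , eq = x , ↔-injective (↔-sym e) eq

-- k ↦ (whether k has an earlier point in its fibre, f k) is injective, hence onto Bool × Fin M.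
module _ {M : ℕ} (f : Fin (2 * M) → Fin M)
  (no-three : ∀ {a b c} → a ≢ b → a ≢ c → b ≢ c → f a ≡ f b → f a ≡ f c → ⊥) where

  private
    HasEarlierMate : Fin (2 * M) → Set
    HasEarlierMate k = ∃ λ k₀ → k₀ <ᶠ k × f k₀ ≡ f k

    hasEarlierMate? : ∀ k → Dec (HasEarlierMate k)
    hasEarlierMate? k = Fin.any? (λ k₀ → (k₀ <ᶠ? k) ×-dec (f k₀ Fin.≟ f k))

    later : Fin (2 * M) → Bool
    later k = does (hasEarlierMate? k)

    earlierMate : ∀ k → later k ≡ true → HasEarlierMate k
    earlierMate k eq with hasEarlierMate? k
    ... | yes mate = mate
    ... | no _ = contradiction eq λ ()

    ¬same-place : ∀ {k k'} → k <ᶠ k' → f k ≡ f k' → later k ≡ later k' → ⊥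
    ¬same-place {k} {k'} k<k' fk≡fk' same with earlierMate k (trans same (dec-true (hasEarlierMate? k') (k , k<k' , fk≡fk')))
    ... | k₀ , k₀<k , fk₀≡fk =
      no-three (Fin.<⇒≢ k₀<k) (Fin.<⇒≢ (Fin.<-trans k₀<k k<k')) (Fin.<⇒≢ k<k') fk₀≡fk (trans fk₀≡fk fk≡fk')

    place : Fin (2 * M) → Bool × Fin M
    place k = later k , f k

    place-injective : Injective _≡_ _≡_ place
    place-injective {k} {k'} eq with ,-injective eq | Fin.<-cmp k k'
    ... | _ | tri≈ _ k≡k' _ = k≡k'
    ... | same , fk≡fk' | tri< k<k' _ _ = ⊥-elim (¬same-place k<k' fk≡fk' same)
    ... | same , fk≡fk' | tri> _ _ k'<k = ⊥-elim (¬same-place k'<k (sym fk≡fk') (sym same))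

    later-differs : ∀ {k k'} → later k' ≡ not (later k) → k' ≢ k
    later-differs {k} eq refl = not-¬ {x = later k} refl eq

  fibre-partner : ∀ i → ∃ λ i' → i' ≢ i × f i' ≡ f i
  fibre-partner i = i' , later-differs (proj₁ (,-injective place-i')) , proj₂ (,-injective place-i')
    where
    hit : ∃ λ k → place k ≡ (not (later i) , f i)
    hit = ↔-injective⇒surjective (↔-trans Fin.*↔× (Fin.2↔Bool ×-↔ ↔-refl)) place-injective (not (later i) , f i)
    i' : Fin (2 * M)
    i' = proj₁ hit
    place-i' : place i' ≡ (not (later i) , f i)
    place-i' = proj₂ hit

module _ {A : Set} {a b : A} where

  ¬three-distinct-in-pair : ∀ {x y z} → x ≡ a ⊎ x ≡ b → y ≡ a ⊎ y ≡ b → z ≡ a ⊎ z ≡ b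
                           → x ≢ y → x ≢ z → y ≢ z → ⊥
  ¬three-distinct-in-pair (inj₁ refl) (inj₁ refl) _           x≢y _   _   = x≢y refl
  ¬three-distinct-in-pair (inj₂ refl) (inj₂ refl) _           x≢y _   _   = x≢y refl
  ¬three-distinct-in-pair (inj₁ refl) _           (inj₁ refl) _   x≢z _   = x≢z refl
  ¬three-distinct-in-pair (inj₂ refl) _           (inj₂ refl) _   x≢z _   = x≢z refl
  ¬three-distinct-in-pair _           (inj₁ refl) (inj₁ refl) _   _   y≢z = y≢z refl
  ¬three-distinct-in-pair _           (inj₂ refl) (inj₂ refl) _   _   y≢z = y≢z refl

testBit-0 : ∀ g → testBit 0 g ≡ false
testBit-0 zero    = refl
testBit-0 (suc g) = testBit-0 g

testBit-2^ : ∀ g → testBit (2 ^ g) g ≡ true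
testBit-2^ zero    = refl
testBit-2^ (suc g) = subst (λ t → testBit t g ≡ true) (sym half) (testBit-2^ g)
  where
  half : 2 ^ suc g / 2 ≡ 2 ^ g
  half = trans (cong (_/ 2) (ℕ.*-comm 2 (2 ^ g))) (m*n/n≡m (2 ^ g) 2)

bits→Fin : ∀ k → (Fin k → Bool) → Fin (2 ^ k)
bits→Fin zero    _ = zero
bits→Fin (suc k) b = combine (Inverse.from Fin.2↔Bool (b zero)) (bits→Fin k (b ∘ suc))

bits→Fin-injective : ∀ k {b b' : Fin k → Bool} → bits→Fin k b ≡ bits→Fin k b' → ∀ γ → b γ ≡ b' γ
bits→Fin-injective (suc k) {b} {b'} eq γ
  with Fin.combine-injective (Inverse.from Fin.2↔Bool (b zero)) (bits→Fin k (b ∘ suc))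
                             (Inverse.from Fin.2↔Bool (b' zero)) (bits→Fin k (b' ∘ suc)) eq
bits→Fin-injective (suc k) eq zero    | head , _ = ↔-injective (↔-sym Fin.2↔Bool) head
bits→Fin-injective (suc k) eq (suc γ) | _ , tail = bits→Fin-injective k tail γ

other : Fin 2 → Fin 2
other zero       = suc zero
other (suc zero) = zero

other≢ : ∀ b → other b ≢ b
other≢ zero       ()
other≢ (suc zero) ()

Fin↣Bool : Fin 2 ↣ Bool
Fin↣Bool = ↔⇒↣ Fin.2↔Bool

module _ (ℓ m : ℕ) where
  private
    DIdxCode : Set
    DIdxCode =
      (Bool × Bool) ⊎ ((Fin 2 × Fin 2) × (Fin 3 × Fin 2)) ⊎ (Fin (L m) × (Fin 3 × Fin 2) × (Fin 3 × Fin 2))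
      ⊎ (Fin 3 × Fin 2) ⊎ ((Fin 3 × Fin 2) × Bool) ⊎ (Fin ℓ × (Fin 3 × Fin 2) × (Bool × Bool))

    decode : DIdxCode → DIdx ℓ m
    decode (inj₁ (c , c'))                                           = d1 c c'
    decode (inj₂ (inj₁ ((a , b) , (α , β))))                         = d2 a b α β
    decode (inj₂ (inj₂ (inj₁ (γ , (α , β) , (α' , β')))))            = d3 γ α β α' β'
    decode (inj₂ (inj₂ (inj₂ (inj₁ (α , β)))))                       = d4 α β
    decode (inj₂ (inj₂ (inj₂ (inj₂ (inj₁ ((α , β) , c))))))          = d5 α β c
    decode (inj₂ (inj₂ (inj₂ (inj₂ (inj₂ (γ , (α , β) , (c , c'))))))) = d6 γ α β c c'

    encode : DIdx ℓ m → DIdxCode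
    encode (d1 c c')         = inj₁ (c , c')
    encode (d2 a b α β)      = inj₂ (inj₁ ((a , b) , (α , β)))
    encode (d3 γ α β α' β')  = inj₂ (inj₂ (inj₁ (γ , (α , β) , (α' , β'))))
    encode (d4 α β)          = inj₂ (inj₂ (inj₂ (inj₁ (α , β))))
    encode (d5 α β c)        = inj₂ (inj₂ (inj₂ (inj₂ (inj₁ ((α , β) , c)))))
    encode (d6 γ α β c c')   = inj₂ (inj₂ (inj₂ (inj₂ (inj₂ (γ , (α , β) , (c , c'))))))

    encode-decode : ∀ (x : DIdxCode) → encode (decode x) ≡ x
    encode-decode (inj₁ _)                               = refl
    encode-decode (inj₂ (inj₁ _))                        = refl
    encode-decode (inj₂ (inj₂ (inj₁ _)))                 = refl
    encode-decode (inj₂ (inj₂ (inj₂ (inj₁ _))))          = refl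
    encode-decode (inj₂ (inj₂ (inj₂ (inj₂ (inj₁ _)))))   = refl
    encode-decode (inj₂ (inj₂ (inj₂ (inj₂ (inj₂ _)))))   = refl

    decode-injective : ∀ {x y : DIdxCode} → decode x ≡ decode y → x ≡ y
    decode-injective {x = x} {y} eq = trans (sym (encode-decode x)) (trans (cong encode eq) (encode-decode y))

    Fin↣Fin3×Fin2 : Fin (3 * 2) ↣ (Fin 3 × Fin 2)
    Fin↣Fin3×Fin2 = Fin*↣× ↣-refl ↣-refl

    |DIdxCode| : ∀ a b → 2 * 2 + (2 * 2 * (3 * 2) + (a * ((3 * 2) * (3 * 2)) + (3 * 2 + (3 * 2 * 2 + b * ((3 * 2) * (2 * 2))))))
                         ≡ 46 + 36 * a + 24 * b
    |DIdxCode| = solve-∀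

  Fin↣DIdx : Fin (46 + 36 * L m + 24 * ℓ) ↣ DIdx ℓ m
  Fin↣DIdx = subst (λ N → Fin N ↣ DIdx ℓ m) (|DIdxCode| (L m) ℓ) (↣-trans codes (mk↣ decode-injective))
    where
    codes : Fin (2 * 2 + (2 * 2 * (3 * 2) + (L m * ((3 * 2) * (3 * 2)) + (3 * 2 + (3 * 2 * 2 + ℓ * ((3 * 2) * (2 * 2)))))))
            ↣ DIdxCode
    codes = Fin+↣⊎ (Fin*↣× Fin↣Bool Fin↣Bool)
           (Fin+↣⊎ (Fin*↣× (Fin*↣× ↣-refl ↣-refl) Fin↣Fin3×Fin2)
           (Fin+↣⊎ (Fin*↣× ↣-refl (Fin*↣× Fin↣Fin3×Fin2 Fin↣Fin3×Fin2))
           (Fin+↣⊎ Fin↣Fin3×Fin2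
           (Fin+↣⊎ (Fin*↣× Fin↣Fin3×Fin2 Fin↣Bool)
                   (Fin*↣× ↣-refl (Fin*↣× Fin↣Fin3×Fin2 (Fin*↣× Fin↣Bool Fin↣Bool)))))))

module Graph {ℓ m : ℕ} (Φ : Formula ℓ m) where
  open Formula Φ

  infix 4 _≁_
  _≁_ : Vertex ℓ m → Vertex ℓ m → Set
  x ≁ y = ¬ Adj Φ x y

  ≁-sym : ∀ {x y} → x ≁ y → y ≁ x
  ≁-sym x≁y = x≁y ∘ [ inj₂ , inj₁ ]′

  w₀≁w₁ : ∀ η i → w η i false ≁ w η i true
  w₀≁w₁ η i (inj₁ (inj₁ (_ , i≢i)))            = i≢i refl
  w₀≁w₁ η i (inj₁ (inj₂ (inj₁ (_ , i≢i , _)))) = i≢i refl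
  w₀≁w₁ η i (inj₁ (inj₂ (inj₂ (η≡0 , η≡1))))   = ℕ.0≢1+n (trans (sym η≡0) η≡1)
  w₀≁w₁ η i (inj₂ (inj₁ ()))
  w₀≁w₁ η i (inj₂ (inj₂ (inj₁ (_ , i≢i , _)))) = i≢i refl
  w₀≁w₁ η i (inj₂ (inj₂ (inj₂ (η≡0 , η≡1))))   = ℕ.0≢1+n (trans (sym η≡0) η≡1)

  u≁u : ∀ η γ η' γ' → u η γ ≁ u η' γ'
  u≁u _ _ _ _ = [ [ (λ ()) , (λ ()) ]′ , [ (λ ()) , (λ ()) ]′ ]′

  u≁w : ∀ {η η'} γ i c → η ≢ η' → u η γ ≁ w η' i c
  u≁w γ i c     η≢η' (inj₁ (inj₁ η≡η')) = η≢η' η≡η'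
  u≁w γ i false η≢η' (inj₂ e)           = [ (λ ()) , (λ ()) ]′ e
  u≁w γ i true  η≢η' (inj₂ e)           = [ (λ ()) , (λ ()) ]′ e

  u≁q : ∀ η γ a b → u η γ ≁ q a b
  u≁q _ _ a zero       = [ [ (λ ()) , (λ ()) ]′ , [ (λ ()) , (λ ()) ]′ ]′
  u≁q _ _ a (suc zero) = [ [ (λ ()) , (λ ()) ]′ , [ (λ ()) , (λ ()) ]′ ]′

  u≁p : ∀ η γ j α β → u η γ ≁ p j α β
  u≁p _ _ j α zero       = [ [ (λ ()) , (λ ()) ]′ , [ (λ ()) , (λ ()) ]′ ]′
  u≁p _ _ j α (suc zero) = [ [ (λ ()) , (λ ()) ]′ , [ (λ ()) , (λ ()) ]′ ]′

  w≁q : ∀ η i c a b → w η i c ≁ q a b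
  w≁q η i false a zero       = [ [ (λ ()) , (λ ()) ]′ , [ (λ ()) , (λ ()) ]′ ]′
  w≁q η i false a (suc zero) = [ [ (λ ()) , (λ ()) ]′ , [ (λ ()) , (λ ()) ]′ ]′
  w≁q η i true  a zero       = [ [ (λ ()) , (λ ()) ]′ , [ (λ ()) , (λ ()) ]′ ]′
  w≁q η i true  a (suc zero) = [ [ (λ ()) , (λ ()) ]′ , [ (λ ()) , (λ ()) ]′ ]′

  q₀≁q₀ : ∀ a a' → q a zero ≁ q a' zero
  q₀≁q₀ a a' = [ [ (λ ()) , (λ ()) ]′ , [ (λ ()) , (λ ()) ]′ ]′

  p₀≁p₀ : ∀ j α α' → p j α zero ≁ p j α' zero
  p₀≁p₀ j α α' = [ [ (λ ()) , (λ j≢j → j≢j refl) ]′ , [ (λ ()) , (λ j≢j → j≢j refl) ]′ ]′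

  p≁w : ∀ j α β η i c → (toℕ i ≡ 0 × c ≡ true) ⊎ (i ≡ var j α × c ≡ not (sgn j α))
      → p j α β ≁ w η i c
  p≁w j α zero       η i c excluded (inj₁ e) = [ (λ ()) , (λ allowed → allowed excluded) ]′ e
  p≁w j α (suc zero) η i c excluded (inj₁ e) = [ (λ ()) , (λ allowed → allowed excluded) ]′ e
  p≁w j α β η i false excluded (inj₂ e) = [ (λ ()) , (λ ()) ]′ e
  p≁w j α β η i true  excluded (inj₂ e) = [ (λ ()) , (λ ()) ]′ e

  s∉D : ∀ d d' → ¬ InD Φ d (s d')
  s∉D (d1 _ _)        _ ()
  s∉D (d2 _ _ _ _)    _ ()
  s∉D (d3 _ _ _ _ _)  _ ()
  s∉D (d4 _ _)        _ ()
  s∉D (d5 _ _ _)      _ ()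
  s∉D (d6 _ _ _ _ _)  _ ()

  u∉D : ∀ d η γ → ¬ InD Φ d (u η γ)
  u∉D (d1 _ _)        _ _ ()
  u∉D (d2 _ _ _ _)    _ _ ()
  u∉D (d3 _ _ _ _ _)  _ _ ()
  u∉D (d4 _ _)        _ _ ()
  u∉D (d5 _ _ _)      _ _ ()
  u∉D (d6 _ _ _ _ _)  _ _ ()

  ¬E-into-s : ∀ x d → ¬ E Φ x (s d)
  ¬E-into-s (w _ _ false)      _ = [ (λ ()) , (λ ()) ]′
  ¬E-into-s (w _ _ true)       _ = [ (λ ()) , (λ ()) ]′
  ¬E-into-s (u _ _)            _ = [ (λ ()) , (λ ()) ]′
  ¬E-into-s (p _ _ zero)       _ = [ (λ ()) , (λ ()) ]′
  ¬E-into-s (p _ _ (suc zero)) _ = [ (λ ()) , (λ ()) ]′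
  ¬E-into-s (q _ zero)         _ = [ (λ ()) , (λ ()) ]′
  ¬E-into-s (q _ (suc zero)) _ = [ (λ ()) , (λ ()) ]′
  ¬E-into-s (s d')             d = s∉D d' d

  s≁ : ∀ d x → ¬ InD Φ d x → s d ≁ x
  s≁ d x x∉D = [ x∉D , ¬E-into-s x d ]′

  D-misses-w : ∀ d η → ∃ λ c → ∀ i → ¬ InD Φ d (w η i c)
  D-misses-w (d1 c₀ c₀') zero       = not c₀ , λ { i (inj₁ (_ , c≡c₀)) → not-¬ refl (sym c≡c₀) ; i (inj₂ (() , _)) }
  D-misses-w (d1 c₀ c₀') (suc zero) = not c₀' , λ { i (inj₁ (() , _)) ; i (inj₂ (_ , c≡c₀')) → not-¬ refl (sym c≡c₀') }
  D-misses-w (d2 _ _ _ _)     _ = false , λ _ ()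
  D-misses-w (d3 _ _ _ _ _)   _ = false , λ _ ()
  D-misses-w (d4 _ _)         _ = true , λ { _ (_ , ()) }
  D-misses-w (d5 _ _ c₀)      _ = not c₀ , λ { _ (_ , c≡c₀) → not-¬ refl (sym c≡c₀) }
  D-misses-w (d6 _ _ _ c₀ _)  _ = not c₀ , λ { _ (c≡c₀ , _) → not-¬ refl (sym c≡c₀) }

  D-misses-q : ∀ d a → ∃ λ b → ¬ InD Φ d (q a b)
  D-misses-q (d1 _ _)          _ = zero , λ ()
  D-misses-q (d2 _ b₀ _ _)     _ = other b₀ , other≢ b₀ ∘ proj₂
  D-misses-q (d3 _ _ _ _ _)    _ = zero , λ ()
  D-misses-q (d4 _ _)          _ = zero , λ ()
  D-misses-q (d5 _ _ _)        _ = zero , λ ()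
  D-misses-q (d6 _ _ _ _ _)    _ = zero , λ ()

  D-misses-p : ∀ d j α → ∃ λ β → ¬ InD Φ d (p j α β)
  D-misses-p (d1 _ _)          _ _ = zero , λ ()
  D-misses-p (d2 _ _ _ β₀)     _ _ = other β₀ , other≢ β₀ ∘ proj₂
  D-misses-p (d3 γ _ β₀ _ β₁)  j _ with testBit (toℕ j) (toℕ γ)
  ... | false = other β₀ , λ { (inj₁ (_ , _ , β≡β₀)) → other≢ β₀ β≡β₀
                             ; (inj₂ (() , _)) }
  ... | true  = other β₁ , λ { (inj₁ (() , _))
                             ; (inj₂ (_ , _ , β≡β₁)) → other≢ β₁ β≡β₁ }
  D-misses-p (d4 _ β₀)         _ _ = other β₀ , other≢ β₀ ∘ proj₂
  D-misses-p (d5 _ β₀ _)       _ _ = other β₀ , other≢ β₀ ∘ proj₁ ∘ proj₂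
  D-misses-p (d6 _ _ β₀ _ _)   _ _ = other β₀ , other≢ β₀ ∘ proj₁ ∘ proj₂

module Witnesses {ℓ' m' : ℕ} (Φ : Formula (2 + ℓ') (suc m')) where

  n : ℕ
  n = 2 ^ (2 + ℓ')

  2^γ<n : ∀ (γ : Fin (2 + ℓ')) → 2 ^ toℕ γ < n
  2^γ<n γ = ℕ.^-monoʳ-< 2 (s≤s (s≤s z≤n)) (Fin.toℕ<n γ)

  2<n : 2 < n
  2<n = ℕ.≤-trans (s≤s (s≤s (s≤s z≤n))) (ℕ.^-monoʳ-≤ 2 {2} {2 + ℓ'} (s≤s (s≤s z≤n)))

  index₀ index₁ : Fin n
  index₀ = fromℕ< (ℕ.<-trans (s≤s z≤n) 2<n)
  index₁ = fromℕ< (ℕ.<-trans (s≤s (s≤s z≤n)) 2<n)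

  index₀-value : toℕ index₀ ≡ 0
  index₀-value = Fin.toℕ-fromℕ< _

  index₁-positive : 1 ≤ toℕ index₁
  index₁-positive rewrite Fin.toℕ-fromℕ< (ℕ.<-trans (s≤s (s≤s z≤n)) 2<n) = s≤s z≤n

  indexWithBit : Fin (2 + ℓ') → Bool → Fin n
  indexWithBit γ       true  = fromℕ< (2^γ<n γ)
  indexWithBit zero    false = fromℕ< 2<n
  indexWithBit (suc γ) false = index₁

  indexWithBit-positive : ∀ γ c → 1 ≤ toℕ (indexWithBit γ c)
  indexWithBit-positive γ       true  rewrite Fin.toℕ-fromℕ< (2^γ<n γ) = ℕ.m^n>0 2 (toℕ γ)
  indexWithBit-positive zero    false rewrite Fin.toℕ-fromℕ< 2<n = s≤s z≤n
  indexWithBit-positive (suc γ) false = index₁-positive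

  indexWithBit-bit : ∀ γ c → testBit (toℕ (indexWithBit γ c)) (toℕ γ) ≡ c
  indexWithBit-bit γ       true  rewrite Fin.toℕ-fromℕ< (2^γ<n γ) = testBit-2^ (toℕ γ)
  indexWithBit-bit zero    false rewrite Fin.toℕ-fromℕ< 2<n = refl
  indexWithBit-bit (suc γ) false rewrite Fin.toℕ-fromℕ< (ℕ.<-trans (s≤s (s≤s z≤n)) 2<n) = testBit-0 (toℕ γ)

  D-nonempty : ∀ d → ∃ λ x → InD Φ d x
  D-nonempty (d1 c _)           = w zero index₁ c , inj₁ (refl , refl)
  D-nonempty (d2 a b _ _)       = q a b , refl , refl
  D-nonempty (d3 γ α β _ _)     = p zero α β , inj₁ (testBit-0 (toℕ γ) , refl , refl)
  D-nonempty (d4 α β)           = w zero index₀ false , index₀-value , refl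
  D-nonempty (d5 α β c)         = w zero index₁ c , index₁-positive , refl
  D-nonempty (d6 γ α β c c')    = w zero (indexWithBit γ c') c , refl , indexWithBit-positive γ c' , indexWithBit-bit γ c'

module Cover {ℓ' m' : ℕ} (Φ : Formula (2 + ℓ') (suc m')) {r : ℕ}
  (C : Fin r → Vertex (2 + ℓ') (suc m') → Bool) (cover : IsCliqueCover Φ r C)
  (r≤k : r ≤ kBound (2 + ℓ') (suc m')) where

  open Formula Φ
  open Graph Φ
  open Witnesses Φ

  infix 4 _∋_
  _∋_ : Fin r → Vertex (2 + ℓ') (suc m') → Set
  t ∋ x = C t x ≡ true

  record CliqueThrough (x y : Vertex (2 + ℓ') (suc m')) : Set where
    field
      clique : Fin r
      ∋x     : clique ∋ x
      ∋y     : clique ∋ y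
  open CliqueThrough

  cliqueThrough : ∀ x y → Adj Φ x y → CliqueThrough x y
  cliqueThrough x y x~y with t , t∋x , t∋y ← proj₂ cover x y x~y = record { clique = t ; ∋x = t∋x ; ∋y = t∋y }

  separated : ∀ {t t' x y} → t ∋ x → t' ∋ y → x ≢ y → x ≁ y → t ≢ t'
  separated {t} t∋x t∋y x≢y x≁y refl = x≁y (proj₁ cover t _ _ t∋x t∋y x≢y)

  ∌-≢ : ∀ {t t' x} → t ∋ x → C t' x ≡ false → t ≢ t'
  ∌-≢ t∋x t'∌x refl with () ← trans (sym t∋x) t'∌x

  sThrough : ∀ d → CliqueThrough (s d) (proj₁ (D-nonempty d))
  sThrough d = cliqueThrough _ _ (inj₁ (proj₂ (D-nonempty d)))

  uThrough : ∀ η γ i c → CliqueThrough (u η γ) (w η i c)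
  uThrough η γ i c = cliqueThrough _ _ (inj₁ (inj₁ refl))

  qThrough : ∀ a → CliqueThrough (q a zero) (q a (suc zero))
  qThrough a = cliqueThrough _ _ (inj₁ (inj₁ refl))

  pThrough : ∀ j α → CliqueThrough (p j α zero) (p j α (suc zero))
  pThrough j α = cliqueThrough _ _ (inj₁ (inj₁ (refl , refl)))

  cross : ∀ η {i i'} → i ≢ i' → CliqueThrough (w η i false) (w η i' true)
  cross η i≢i' = cliqueThrough _ _ (inj₁ (inj₁ (refl , i≢i')))

  sClique : DIdx (2 + ℓ') (suc m') → Fin r
  sClique d = clique (sThrough d)

  uClique : Fin 2 → Fin (suc ℓ') → Bool → Fin r
  uClique η γ c = clique (uThrough η γ index₀ c)

  qClique : Fin 2 → Fin r
  qClique a = clique (qThrough a)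

  qClique∋ : ∀ a b → qClique a ∋ q a b
  qClique∋ a zero       = ∋x (qThrough a)
  qClique∋ a (suc zero) = ∋y (qThrough a)

  pClique : Fin (suc m') → Fin 3 → Fin r
  pClique j α = clique (pThrough j α)

  pClique∋ : ∀ j α β → pClique j α ∋ p j α β
  pClique∋ j α zero       = ∋x (pThrough j α)
  pClique∋ j α (suc zero) = ∋y (pThrough j α)

  ≢sClique : ∀ {t x} d → t ∋ x → x ≢ s d → ¬ InD Φ d x → t ≢ sClique d
  ≢sClique d t∋x x≢s x∉D = separated t∋x (∋x (sThrough d)) x≢s (≁-sym (s≁ d _ x∉D))

  w-colours-split : ∀ {t t'} η i → t ∋ w η i false → t' ∋ w η i true → t ≢ t'
  w-colours-split η i t∋w₀ t'∋w₁ = separated t∋w₀ t'∋w₁ (λ ()) (w₀≁w₁ η i)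

  BaseToken : Set
  BaseToken = DIdx (2 + ℓ') (suc m') ⊎ (Fin 2 × Fin (suc ℓ') × Bool) ⊎ Fin 2

  baseClique : BaseToken → Fin r
  baseClique (inj₁ d)                 = sClique d
  baseClique (inj₂ (inj₁ (η , γ , c))) = uClique η γ c
  baseClique (inj₂ (inj₂ a))          = qClique a

  uClique-≢ : ∀ {η γ c η' γ' c'} → (η , γ , c) ≢ (η' , γ' , c') → uClique η γ c ≢ uClique η' γ' c'
  uClique-≢ {η} {γ} {c} {η'} {γ'} {c'} ne with η Fin.≟ η' | γ Fin.≟ γ'
  ... | no η≢η'  | _        = separated (∋x (uThrough η γ index₀ c)) (∋x (uThrough η' γ' index₀ c'))
                                        (λ { refl → η≢η' refl }) (u≁u η γ η' γ')
  ... | yes refl | no γ≢γ'  = separated (∋x (uThrough η γ index₀ c)) (∋x (uThrough η γ' index₀ c'))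
                                        (λ { refl → γ≢γ' refl }) (u≁u η γ η γ')
  ... | yes refl | yes refl = colours c c' (ne ∘ cong (λ c → η , γ , c))
    where
    colours : ∀ c c' → c ≢ c' → uClique η γ c ≢ uClique η γ c'
    colours false false c≢c' = contradiction refl c≢c'
    colours true  true  c≢c' = contradiction refl c≢c'
    colours false true  _    = w-colours-split η index₀ (∋y (uThrough η γ index₀ false)) (∋y (uThrough η γ index₀ true))
    colours true  false _    = ≢-sym (colours false true λ ())

  uClique≢sClique : ∀ η γ c d → uClique η γ c ≢ sClique d
  uClique≢sClique η γ c d = ≢sClique d (∋x (uThrough η γ index₀ c)) (λ ()) (u∉D d η γ)

  qClique≢sClique : ∀ a d → qClique a ≢ sClique d
  qClique≢sClique a d with b , q∉D ← D-misses-q d a = ≢sClique d (qClique∋ a b) (λ ()) q∉D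

  uClique≢qClique : ∀ η γ c a → uClique η γ c ≢ qClique a
  uClique≢qClique η γ c a = separated (∋x (uThrough η γ index₀ c)) (qClique∋ a zero) (λ ()) (u≁q η γ a zero)

  baseClique-≢ : ∀ {τ τ'} → τ ≢ τ' → baseClique τ ≢ baseClique τ'
  baseClique-≢ {inj₁ d} {inj₁ d'} ne =
    separated (∋x (sThrough d)) (∋x (sThrough d')) (λ { refl → ne refl }) (s≁ d (s d') (s∉D d d'))
  baseClique-≢ {inj₁ d} {inj₂ (inj₁ (η , γ , c))} _ = ≢-sym (uClique≢sClique η γ c d)
  baseClique-≢ {inj₁ d} {inj₂ (inj₂ a)} _ = ≢-sym (qClique≢sClique a d)
  baseClique-≢ {inj₂ (inj₁ (η , γ , c))} {inj₁ d} _ = uClique≢sClique η γ c d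
  baseClique-≢ {inj₂ (inj₁ _)} {inj₂ (inj₁ _)} ne = uClique-≢ (ne ∘ cong (inj₂ ∘ inj₁))
  baseClique-≢ {inj₂ (inj₁ (η , γ , c))} {inj₂ (inj₂ a)} _ = uClique≢qClique η γ c a
  baseClique-≢ {inj₂ (inj₂ a)} {inj₁ d} _ = qClique≢sClique a d
  baseClique-≢ {inj₂ (inj₂ a)} {inj₂ (inj₁ (η , γ , c))} _ = ≢-sym (uClique≢qClique η γ c a)
  baseClique-≢ {inj₂ (inj₂ a)} {inj₂ (inj₂ a')} ne =
    separated (qClique∋ a zero) (qClique∋ a' zero) (λ { refl → ne refl }) (q₀≁q₀ a a')

  Fresh : Fin r → Set
  Fresh t = ∀ τ → t ≢ baseClique τ

  fresh : ∀ {t} → (∀ d → t ≢ sClique d) → (∀ η γ c → t ≢ uClique η γ c) → (∀ a → t ≢ qClique a) → Fresh t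
  fresh ≢s ≢u ≢q (inj₁ d)                 = ≢s d
  fresh ≢s ≢u ≢q (inj₂ (inj₁ (η , γ , c))) = ≢u η γ c
  fresh ≢s ≢u ≢q (inj₂ (inj₂ a))          = ≢q a

  Fin↣BaseToken : Fin (46 + 36 * L (suc m') + 24 * (2 + ℓ') + (2 * (suc ℓ' * 2) + 2)) ↣ BaseToken
  Fin↣BaseToken = Fin+↣⊎ (Fin↣DIdx (2 + ℓ') (suc m')) (Fin+↣⊎ (Fin*↣× ↣-refl (Fin*↣× ↣-refl Fin↣Bool)) ↣-refl)

  -- the base cliques already use k - 2 of the at most k cliques
  no-three-fresh : ∀ {t₁ t₂ t₃} → Fresh t₁ → Fresh t₂ → Fresh t₃ → t₁ ≢ t₂ → t₁ ≢ t₃ → t₂ ≢ t₃ → ⊥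
  no-three-fresh f₁ f₂ f₃ t₁≢t₂ t₁≢t₃ t₂≢t₃ = ℕ.1+n≰n (ℕ.≤-trans (subst (_≤ r) |BaseToken|+3 count) r≤k)
    where
    count : 46 + 36 * L (suc m') + 24 * (2 + ℓ') + (2 * (suc ℓ' * 2) + 2) + 3 ≤ r
    count = ≢-preserving+3⇒≤ Fin↣BaseToken baseClique baseClique-≢ f₁ f₂ f₃ t₁≢t₂ t₁≢t₃ t₂≢t₃

    |BaseToken|+3 : 46 + 36 * L (suc m') + 24 * (2 + ℓ') + (2 * (suc ℓ' * 2) + 2) + 3 ≡ suc (kBound (2 + ℓ') (suc m'))
    |BaseToken|+3 = arith (L (suc m')) ℓ'
      where
      arith : ∀ x y → 46 + 36 * x + 24 * (2 + y) + (2 * (suc y * 2) + 2) + 3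
                    ≡ suc (4 * (2 + y) + 46 + 36 * x + 24 * (2 + y))
      arith = solve-∀

  fresh-either : ∀ {t F₁ F₂} → Fresh F₁ → Fresh F₂ → F₁ ≢ F₂ → Fresh t → t ≡ F₁ ⊎ t ≡ F₂
  fresh-either {t} {F₁} {F₂} f₁ f₂ F₁≢F₂ f with t Fin.≟ F₁ | t Fin.≟ F₂
  ... | yes t≡F₁ | _        = inj₁ t≡F₁
  ... | no _     | yes t≡F₂ = inj₂ t≡F₂
  ... | no t≢F₁  | no t≢F₂  = ⊥-elim (no-three-fresh f₁ f₂ f F₁≢F₂ (≢-sym t≢F₁) (≢-sym t≢F₂))

  MissedAt : Fin 2 → Fin (suc ℓ') → Fin n → Bool → Set
  MissedAt η γ i c = ∀ c' → C (uClique η γ c') (w η i c) ≡ false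

  Missed : Fin 2 → Set
  Missed η = ∃ λ γ → ∃ λ i → ∃ λ c → MissedAt η γ i c

  UCovers : Fin 2 → Set
  UCovers η = ∀ γ i c → uClique η γ false ∋ w η i c ⊎ uClique η γ true ∋ w η i c

  missedAt? : ∀ η γ i c → Dec (MissedAt η γ i c)
  missedAt? η γ i c with C (uClique η γ false) (w η i c) in e₀ | C (uClique η γ true) (w η i c) in e₁
  ... | false | false = yes λ { false → e₀ ; true → e₁ }
  ... | true  | _     = no λ missed → contradiction (trans (sym e₀) (missed false)) λ ()
  ... | false | true  = no λ missed → contradiction (trans (sym e₁) (missed true)) λ ()

  ¬missedAt⇒covered : ∀ {η γ i c} → ¬ MissedAt η γ i c → uClique η γ false ∋ w η i c ⊎ uClique η γ true ∋ w η i c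
  ¬missedAt⇒covered {η} {γ} {i} {c} ¬missed with C (uClique η γ false) (w η i c) in e₀ | C (uClique η γ true) (w η i c) in e₁
  ... | true  | _     = inj₁ refl
  ... | false | true  = inj₂ refl
  ... | false | false = ⊥-elim (¬missed λ { false → e₀ ; true → e₁ })

  uCovers? : ∀ η → UCovers η ⊎ Missed η
  uCovers? η with Fin.any? (λ γ → Fin.any? (λ i → missedAt? η γ i false ⊎-dec missedAt? η γ i true))
  ... | yes (γ , i , inj₁ missed) = inj₂ (γ , i , false , missed)
  ... | yes (γ , i , inj₂ missed) = inj₂ (γ , i , true , missed)
  ... | no none = inj₁ λ γ i c → ¬missedAt⇒covered (none ∘ λ missed → γ , i , tagged c missed)
    where
    tagged : ∀ {γ i} c → MissedAt η γ i c → MissedAt η γ i false ⊎ MissedAt η γ i true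
    tagged false = inj₁
    tagged true  = inj₂

  missed-fresh : ∀ {η γ i c} → MissedAt η γ i c → Fresh (clique (uThrough η γ i c))
  missed-fresh {η} {γ} {i} {c} missed = fresh ≢s ≢u ≢q
    where
    Y : CliqueThrough (u η γ) (w η i c)
    Y = uThrough η γ i c
    ≢s : ∀ d → clique Y ≢ sClique d
    ≢s d = ≢sClique d (∋x Y) (λ ()) (u∉D d η γ)
    ≢u : ∀ η' γ' c' → clique Y ≢ uClique η' γ' c'
    ≢u η' γ' c' with η Fin.≟ η' | γ Fin.≟ γ'
    ... | yes refl | yes refl = ∌-≢ (∋y Y) (missed c')
    ... | no η≢η'  | _        = separated (∋x Y) (∋x (uThrough η' γ' index₀ c')) (λ { refl → η≢η' refl }) (u≁u η γ η' γ')
    ... | yes refl | no γ≢γ'  = separated (∋x Y) (∋x (uThrough η γ' index₀ c')) (λ { refl → γ≢γ' refl }) (u≁u η γ η γ')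
    ≢q : ∀ a → clique Y ≢ qClique a
    ≢q a = separated (∋x Y) (qClique∋ a zero) (λ ()) (u≁q η γ a zero)

  UncoveredByU : Fin 2 → Fin n → Fin n → Set
  UncoveredByU η i i' = ∀ γ c → uClique η γ c ∋ w η i false → uClique η γ c ∋ w η i' true → ⊥

  cross-fresh : ∀ {η i i'} (i≢i' : i ≢ i') → UncoveredByU η i i' → Fresh (clique (cross η i≢i'))
  cross-fresh {η} {i} {i'} i≢i' uncovered = fresh ≢s ≢u ≢q
    where
    T : CliqueThrough (w η i false) (w η i' true)
    T = cross η i≢i'
    ≢s : ∀ d → clique T ≢ sClique d
    ≢s d with D-misses-w d η
    ... | false , w∉D = ≢sClique d (∋x T) (λ ()) (w∉D i)
    ... | true  , w∉D = ≢sClique d (∋y T) (λ ()) (w∉D i')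
    ≢u : ∀ η' γ c → clique T ≢ uClique η' γ c
    ≢u η' γ c with η' Fin.≟ η
    ... | yes refl = λ T≡u → uncovered γ c (subst (_∋ w η i false) T≡u (∋x T)) (subst (_∋ w η i' true) T≡u (∋y T))
    ... | no η'≢η  = ≢-sym (separated (∋x (uThrough η' γ index₀ c)) (∋x T) (λ ()) (u≁w γ i false η'≢η))
    ≢q : ∀ a → clique T ≢ qClique a
    ≢q a = separated (∋x T) (qClique∋ a zero) (λ ()) (w≁q η i false a zero)

  signatureBit : Fin 2 → Fin n → Fin (suc ℓ') → Bool
  signatureBit η i γ = C (uClique η γ false) (w η i true)

  signature : Fin 2 → Fin n → Fin (2 ^ suc ℓ')
  signature η i = bits→Fin (suc ℓ') (signatureBit η i)

  signature-injective : ∀ {η i i'} → signature η i ≡ signature η i' → ∀ γ → signatureBit η i γ ≡ signatureBit η i' γ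
  signature-injective {η} {i} {i'} = bits→Fin-injective (suc ℓ') {signatureBit η i} {signatureBit η i'}

  same-signature⇒uncovered : ∀ {η i i'} → UCovers η → signature η i ≡ signature η i' → UncoveredByU η i i'
  same-signature⇒uncovered {η} {i} {i'} covers same γ false A∋wᵢ₀ A∋wᵢ'₁ =
    w-colours-split η i A∋wᵢ₀ (trans (signature-injective same γ) A∋wᵢ'₁) refl
  same-signature⇒uncovered {η} {i} {i'} covers same γ true B∋wᵢ₀ B∋wᵢ'₁ with C (uClique η γ false) (w η i true) in bitᵢ
  ... | true with covers γ i' false
  ...   | inj₁ A∋wᵢ'₀ = w-colours-split η i' A∋wᵢ'₀ (trans (sym (signature-injective same γ)) bitᵢ) refl
  ...   | inj₂ B∋wᵢ'₀ = w-colours-split η i' B∋wᵢ'₀ B∋wᵢ'₁ refl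
  same-signature⇒uncovered {η} {i} {i'} covers same γ true B∋wᵢ₀ B∋wᵢ'₁ | false with covers γ i true
  ...   | inj₁ A∋wᵢ₁ = contradiction (trans (sym A∋wᵢ₁) bitᵢ) λ ()
  ...   | inj₂ B∋wᵢ₁ = w-colours-split η i B∋wᵢ₀ B∋wᵢ₁ refl

  same-signature-fresh : ∀ {η i i'} → UCovers η → (i≢i' : i ≢ i') → signature η i ≡ signature η i'
                       → Fresh (clique (cross η i≢i'))
  same-signature-fresh covers i≢i' same = cross-fresh i≢i' (same-signature⇒uncovered covers same)

  pClique-≢ : ∀ j {α α'} → α ≢ α' → pClique j α ≢ pClique j α'
  pClique-≢ j {α} {α'} α≢α' = separated (pClique∋ j α zero) (pClique∋ j α' zero) (λ { refl → α≢α' refl }) (p₀≁p₀ j α α')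

  pClique-fresh : ∀ {j α} → (∀ a → pClique j α ≢ qClique a) → Fresh (pClique j α)
  pClique-fresh {j} {α} ≢q = fresh ≢s ≢u ≢q
    where
    ≢s : ∀ d → pClique j α ≢ sClique d
    ≢s d with β , p∉D ← D-misses-p d j α = ≢sClique d (pClique∋ j α β) (λ ()) p∉D
    ≢u : ∀ η γ c → pClique j α ≢ uClique η γ c
    ≢u η γ c = ≢-sym (separated (∋x (uThrough η γ index₀ c)) (pClique∋ j α zero) (λ ()) (u≁p η γ j α zero))

  clause-fresh : ∀ j → ∃ λ α → Fresh (pClique j α)
  clause-fresh j with q? zero | q? (suc zero) | q? (suc (suc zero))
    where
    q? : ∀ α → (pClique j α ≡ qClique zero ⊎ pClique j α ≡ qClique (suc zero)) ⊎ (∀ a → pClique j α ≢ qClique a)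
    q? α with pClique j α Fin.≟ qClique zero | pClique j α Fin.≟ qClique (suc zero)
    ... | yes eq | _      = inj₁ (inj₁ eq)
    ... | no _   | yes eq = inj₁ (inj₂ eq)
    ... | no ≢q₀ | no ≢q₁ = inj₂ λ { zero → ≢q₀ ; (suc zero) → ≢q₁ }
  ... | inj₂ ≢q | _      | _      = zero , pClique-fresh ≢q
  ... | inj₁ _  | inj₂ ≢q | _      = suc zero , pClique-fresh ≢q
  ... | inj₁ _  | inj₁ _  | inj₂ ≢q = suc (suc zero) , pClique-fresh ≢q
  ... | inj₁ q₀ | inj₁ q₁ | inj₁ q₂ =
    ⊥-elim (¬three-distinct-in-pair q₀ q₁ q₂ (pClique-≢ j λ ()) (pClique-≢ j λ ()) (pClique-≢ j λ ()))

  ¬missed-missed : Missed zero → Missed (suc zero) → ⊥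
  ¬missed-missed (γ₀ , i₀ , c₀ , missed₀) (γ₁ , i₁ , c₁ , missed₁) with α , P-fresh ← clause-fresh zero =
    no-three-fresh (missed-fresh missed₀) (missed-fresh missed₁) P-fresh
      (separated (∋x Y₀) (∋x Y₁) (λ ()) (u≁u zero γ₀ (suc zero) γ₁))
      (separated (∋x Y₀) (pClique∋ zero α zero) (λ ()) (u≁p zero γ₀ zero α zero))
      (separated (∋x Y₁) (pClique∋ zero α zero) (λ ()) (u≁p (suc zero) γ₁ zero α zero))
    where
    Y₀ : CliqueThrough (u zero γ₀) (w zero i₀ c₀)
    Y₀ = uThrough zero γ₀ i₀ c₀
    Y₁ : CliqueThrough (u (suc zero) γ₁) (w (suc zero) i₁ c₁)
    Y₁ = uThrough (suc zero) γ₁ i₁ c₁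

  ¬missed-covered : Missed zero → UCovers (suc zero) → ⊥
  ¬missed-covered (γ , i₀ , c , missed) covers
    with i , i' , i<i' , same ← Fin.pigeonhole (ℕ.^-monoʳ-< 2 (s≤s (s≤s z≤n)) (ℕ.n<1+n (suc ℓ'))) (signature (suc zero)) =
    no-three-fresh (missed-fresh missed) (same-signature-fresh covers i≢i' same) (same-signature-fresh covers i'≢i (sym same))
      (separated (∋x Y) (∋x X) (λ ()) (u≁w γ i false λ ()))
      (separated (∋x Y) (∋y X') (λ ()) (u≁w γ i true λ ()))
      (w-colours-split (suc zero) i (∋x X) (∋y X'))
    where
    i≢i' : i ≢ i'
    i≢i' = Fin.<⇒≢ i<i'
    i'≢i : i' ≢ i
    i'≢i = ≢-sym i≢i'
    Y : CliqueThrough (u zero γ) (w zero i₀ c)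
    Y = uThrough zero γ i₀ c
    X : CliqueThrough (w (suc zero) i false) (w (suc zero) i' true)
    X = cross (suc zero) i≢i'
    X' : CliqueThrough (w (suc zero) i' false) (w (suc zero) i true)
    X' = cross (suc zero) i'≢i

  module Satisfying (covers : UCovers zero) where

    crossFresh : ∀ {i i'} (i≢i' : i ≢ i') → signature zero i ≡ signature zero i' → Fresh (clique (cross zero i≢i'))
    crossFresh = same-signature-fresh covers

    -- T(a,b), T(b,c), T(c,a) pairwise disagree on the colour of a shared index
    no-three-same-signature : ∀ {a b c} → a ≢ b → a ≢ c → b ≢ c
                            → signature zero a ≡ signature zero b → signature zero a ≡ signature zero c → ⊥
    no-three-same-signature {a} {b} {c} a≢b a≢c b≢c ab ac =
      no-three-fresh (crossFresh a≢b ab) (crossFresh b≢c (trans (sym ab) ac)) (crossFresh (≢-sym a≢c) (sym ac))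
        (w-colours-split zero b (∋x Tbc) (∋y Tab) ∘ sym)
        (w-colours-split zero a (∋x Tab) (∋y Tca))
        (w-colours-split zero c (∋x Tca) (∋y Tbc) ∘ sym)
      where
      Tab : CliqueThrough (w zero a false) (w zero b true)
      Tab = cross zero a≢b
      Tbc : CliqueThrough (w zero b false) (w zero c true)
      Tbc = cross zero b≢c
      Tca : CliqueThrough (w zero c false) (w zero a true)
      Tca = cross zero (≢-sym a≢c)

    partnerOf : ∀ i → ∃ λ i' → i' ≢ i × signature zero i' ≡ signature zero i
    partnerOf = fibre-partner (signature zero) no-three-same-signature

    j₀ : Fin n
    j₀ = proj₁ (partnerOf index₀)

    j₀≢i₀ : j₀ ≢ index₀
    j₀≢i₀ = proj₁ (proj₂ (partnerOf index₀))

    O : CliqueThrough (w zero index₀ false) (w zero j₀ true)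
    O = cross zero (≢-sym j₀≢i₀)

    Z : CliqueThrough (w zero j₀ false) (w zero index₀ true)
    Z = cross zero j₀≢i₀

    fresh⇒O-or-Z : ∀ {t} → Fresh t → t ≡ clique O ⊎ t ≡ clique Z
    fresh⇒O-or-Z = fresh-either (crossFresh _ (sym (proj₂ (proj₂ (partnerOf index₀)))))
                                (crossFresh _ (proj₂ (proj₂ (partnerOf index₀))))
                                (w-colours-split zero index₀ (∋x O) (∋y Z))

    O-decides : ∀ i → clique O ∋ w zero i false ⊎ clique O ∋ w zero i true
    O-decides i = decide (proj₁ (proj₂ (partnerOf i))) (proj₂ (proj₂ (partnerOf i)))
      where
      decide : ∀ {i'} → i' ≢ i → signature zero i' ≡ signature zero i → clique O ∋ w zero i false ⊎ clique O ∋ w zero i true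
      decide {i'} i'≢i same = choose (fresh⇒O-or-Z (crossFresh (≢-sym i'≢i) (sym same))) (fresh⇒O-or-Z (crossFresh i'≢i same))
        where
        T : CliqueThrough (w zero i false) (w zero i' true)
        T = cross zero (≢-sym i'≢i)
        T' : CliqueThrough (w zero i' false) (w zero i true)
        T' = cross zero i'≢i
        choose : clique T ≡ clique O ⊎ clique T ≡ clique Z → clique T' ≡ clique O ⊎ clique T' ≡ clique Z
               → clique O ∋ w zero i false ⊎ clique O ∋ w zero i true
        choose (inj₁ T≡O) _           = inj₁ (subst (_∋ w zero i false) T≡O (∋x T))
        choose (inj₂ _)   (inj₁ T'≡O) = inj₂ (subst (_∋ w zero i true) T'≡O (∋y T'))
        choose (inj₂ T≡Z) (inj₂ T'≡Z) = ⊥-elim (w-colours-split zero i (∋x T) (∋y T') (trans T≡Z (sym T'≡Z)))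

    fresh-pClique-in-O : ∀ {j α} → Fresh (pClique j α) → clique O ∋ p j α zero
    fresh-pClique-in-O {j} {α} P-fresh = [ in-O , ⊥-elim ∘ ≢Z ]′ (fresh⇒O-or-Z P-fresh)
      where
      in-O : pClique j α ≡ clique O → clique O ∋ p j α zero
      in-O P≡O = subst (_∋ p j α zero) P≡O (pClique∋ j α zero)
      ≢Z : pClique j α ≢ clique Z
      ≢Z = separated (pClique∋ j α zero) (∋y Z) (λ ()) (p≁w j α zero zero index₀ true (inj₁ (index₀-value , refl)))

    O-meets-clause : ∀ j → ∃ λ α → clique O ∋ p j α zero
    O-meets-clause j = map₂ fresh-pClique-in-O (clause-fresh j)

    assignment : Fin n → Bool
    assignment i = C (clique O) (w zero i true)

    O∌negated-literal : ∀ {j α c} → clique O ∋ p j α zero → clique O ∋ w zero (var j α) c → c ≢ not (sgn j α)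
    O∌negated-literal {j} {α} {c} O∋p O∋w c≡¬sgn =
      separated O∋p O∋w (λ ()) (p≁w j α zero zero (var j α) c (inj₂ (refl , c≡¬sgn))) refl

    literal-true : ∀ j α → clique O ∋ p j α zero → assignment (var j α) ≡ sgn j α
    literal-true j α O∋p = agree (sgn j α) refl (O-decides (var j α))
      where
      agree : ∀ b → sgn j α ≡ b → clique O ∋ w zero (var j α) false ⊎ clique O ∋ w zero (var j α) true
            → assignment (var j α) ≡ b
      agree true  _    (inj₂ O∋w₁) = O∋w₁
      agree true  sign (inj₁ O∋w₀) = ⊥-elim (O∌negated-literal O∋p O∋w₀ (cong not (sym sign)))
      agree false sign _           = ¬-not λ O∋w₁ → O∌negated-literal O∋p O∋w₁ (cong not (sym sign))

    satisfiable : Satisfiable Φ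
    satisfiable = assignment , λ j → let α , O∋p = O-meets-clause j in α , literal-true j α O∋p

  satisfiable : Satisfiable Φ
  satisfiable with uCovers? zero | uCovers? (suc zero)
  ... | inj₁ covers₀ | _            = Satisfying.satisfiable covers₀
  ... | inj₂ missed₀ | inj₁ covers₁ = ⊥-elim (¬missed-covered missed₀ covers₁)
  ... | inj₂ missed₀ | inj₂ missed₁ = ⊥-elim (¬missed-missed missed₀ missed₁)

nonzero-Fin2 : ∀ (a : Fin 2) → toℕ a ≢ 0 → a ≡ suc zero
nonzero-Fin2 zero       a≢0 = contradiction refl a≢0
nonzero-Fin2 (suc zero) _   = refl

lemma12 : (ℓ m : ℕ) → 1 ≤ ℓ → 1 ≤ m → (Φ : Formula ℓ m) → WellFormed Φ
    → (r : ℕ) → r ≤ kBound ℓ m → (C : Fin r → Vertex ℓ m → Bool)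
    → IsCliqueCover Φ r C → Satisfiable Φ
lemma12 zero           _        ()  _  _ _ _ _ _ _
lemma12 (suc _)        zero     _   () _ _ _ _ _ _
lemma12 (suc (suc ℓ')) (suc m') _ _ Φ _ r r≤k C cover = Cover.satisfiable Φ C cover r≤k
-- For ℓ = 1 the only variable other than x_0 is x_1, so no clause has three distinct variables.
lemma12 1 (suc m') _ _ Φ (distinct , nonzero) _ _ _ _ =
  ⊥-elim (distinct zero zero (suc zero) (λ ())
    (trans (nonzero-Fin2 (var zero zero) (nonzero zero zero)) (sym (nonzero-Fin2 (var zero (suc zero)) (nonzero zero (suc zero))))))
  where open Formula Φ
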